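{- If $J_1$ is a graph on $n_1$ vertices, $J_2$ is a graph on $n_2$ vertices, and $S$ is a finite set, then $\tilde{\jmath}(J_1,S;x)\,\tilde{\jmath}(J_2,S;x)$ is a sum of polynomials $\tilde{\jmath}(J,S;x)$, where no graph $J$ occurring has more than $n_1+n_2$ vertices.
   Context: All graphs are finite and simple. For a finite set $S$, $E(K_S)$ is the set of 2-element subsets of $S$, and $R_S=\mathbb{R}[x_e \mid e\in E(K_S)]/\langle x_e^2-1 \mid e\in E(K_S)\rangle$; we write $x_{ab}$ for $x_{\{a,b\}}$. $\mathrm{inj}(A,B)$ is the set of injective maps $A\to B$. For an injection $\phi$ and an edge $e=uv$, $x_{\phi(e)}$ means $x_{\phi(u)\phi(v)}$. For a graph $J$ and set $S$, \[ \tilde{\jmath}(J,S;x) = \sum_{\phi \in \mathrm{inj}(V(J),S)} \prod_{e\in E(J)} x_{\phi(e)} \in R_S. \] -}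

module Defs where

open import Data.Bool using (Bool; true; false; _∧_; _∨_; _xor_; not; if_then_else_; T)
open import Data.Nat using (ℕ; zero; suc)
open import Data.Fin using (Fin; zero; suc; _<?_)
import Data.Fin as Fin
open import Data.Integer using (ℤ; _*_; _+_; 0ℤ; 1ℤ)
open import Data.List using (List; []; _∷_; map; concatMap; allFin; filterᵇ; foldr; _++_)
open import Data.Bool.ListAction using (and)
open import Data.Product using (_×_; _,_; Σ)
open import Relation.Nullary.Decidable using (⌊_⌋)
open import Relation.Binary.PropositionalEquality using (_≡_)

record Graph (n : ℕ) : Set where
  field
    adj    : Fin n → Fin n → Bool
    sym    : ∀ u v → adj u v ≡ adj v u
    irrefl : ∀ u → adj u u ≡ false
open Graph public

_=ᶠ_ : ∀ {k} → Fin k → Fin k → Bool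
a =ᶠ b = ⌊ a Fin.≟ b ⌋

_<ᶠ_ : ∀ {k} → Fin k → Fin k → Bool
a <ᶠ b = ⌊ a <? b ⌋

pairs : (k : ℕ) → List (Fin k × Fin k)
pairs k = concatMap (λ u → map (λ v → (u , v)) (filterᵇ (λ v → u <ᶠ v) (allFin k))) (allFin k)

edges : ∀ {n} → Graph n → List (Fin n × Fin n)
edges {n} J = filterᵇ (λ p → adj J (Data.Product.proj₁ p) (Data.Product.proj₂ p)) (pairs n)

-- The ring R_S for S = Fin s, with integer coefficients.
-- Since x_e^2 = 1, R_S is spanned (freely) by square-free monomials
-- ∏_{e ∈ M} x_e, M ⊆ E(K_S).  A monomial is given by its exponent
-- (mod 2) m a b for each pair a < b (entries with a ≥ b are ignored).
Mon : ℕ → Set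
Mon s = Fin s → Fin s → Bool

monEq : ∀ {s} → Mon s → Mon s → Bool
monEq {s} m m' = and (map (λ p → not (m (Data.Product.proj₁ p) (Data.Product.proj₂ p)
                                    xor m' (Data.Product.proj₁ p) (Data.Product.proj₂ p)))
                         (pairs s))

monMul : ∀ {s} → Mon s → Mon s → Mon s
monMul m m' a b = m a b xor m' a b

-- An element of R_S presented as a formal Z-linear combination of monomials
Poly : ℕ → Set
Poly s = List (ℤ × Mon s)

_⊕_ : ∀ {s} → Poly s → Poly s → Poly s
p ⊕ q = p ++ q

_⊗_ : ∀ {s} → Poly s → Poly s → Poly s
p ⊗ q = concatMap (λ cm → map (λ dn → (Data.Product.proj₁ cm * Data.Product.proj₁ dn ,
                                       monMul (Data.Product.proj₂ cm) (Data.Product.proj₂ dn))) q) p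

zeroP : ∀ {s} → Poly s
zeroP = []

coeff : ∀ {s} → Mon s → Poly s → ℤ
coeff m p = foldr (λ cm acc → (if monEq m (Data.Product.proj₂ cm) then Data.Product.proj₁ cm else 0ℤ) + acc) 0ℤ p

_≈ᴿ_ : ∀ {s} → Poly s → Poly s → Set
_≈ᴿ_ {s} p q = (m : Mon s) → coeff m p ≡ coeff m q

sumP : ∀ {s} → List (Poly s) → Poly s
sumP = foldr _⊕_ zeroP

consF : ∀ {n s} → Fin s → (Fin n → Fin s) → Fin (suc n) → Fin s
consF a f zero = a
consF a f (suc i) = f i

allMaps : (n s : ℕ) → List (Fin n → Fin s)
allMaps zero s = (λ ()) ∷ []
allMaps (suc n) s = concatMap (λ f → map (λ a → consF a f) (allFin s)) (allMaps n s)

isInjective : ∀ {n s} → (Fin n → Fin s) → Bool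
isInjective {n} φ = and (map (λ p → not (φ (Data.Product.proj₁ p) =ᶠ φ (Data.Product.proj₂ p))) (pairs n))

inj : (n s : ℕ) → List (Fin n → Fin s)
inj n s = filterᵇ isInjective (allMaps n s)

hits : ∀ {s} → Fin s → Fin s → Fin s → Fin s → Bool
hits a b c d = ((c =ᶠ a) ∧ (d =ᶠ b)) ∨ ((c =ᶠ b) ∧ (d =ᶠ a))

monOf : ∀ {n s} → Graph n → (Fin n → Fin s) → Mon s
monOf J φ a b = foldr (λ uv acc → hits a b (φ (Data.Product.proj₁ uv)) (φ (Data.Product.proj₂ uv)) xor acc)
                      false (edges J)

jtilde : ∀ {n} → Graph n → (s : ℕ) → Poly s
jtilde J s = map (λ φ → (1ℤ , monOf J φ)) (inj _ s)

module Submission where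

-- The coefficient of M in j̃(J₁,S) j̃(J₂,S) counts pairs of injections
-- (φ₁ , φ₂) whose monomials multiply to M.  Such a pair is one map Φ on
-- the disjoint union Fin (n₁ + n₂), injective on each side.  Every map Φ
-- factors uniquely as ψ ∘ collapse p, where p is a set partition
-- ("pattern") of Fin (n₁ + n₂) into m ≤ n₁ + n₂ blocks and ψ is
-- injective on the blocks.  Gluing J₁ and J₂ along p gives a graph J_p
-- on m vertices (multiple edges cancel, as x_e² = 1) whose monomial under
-- ψ is the product monomial; so the product is the sum of the j̃(J_p, S)
-- over the patterns p that are injective on both sides.

open import Level using (0ℓ)
open import Algebra.Bundles using (CommutativeRing)
open import Data.Bool using (Bool; true; false; _∧_; _∨_; _xor_; not; if_then_else_)
open import Data.Bool.ListAction using (and)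
open import Data.Bool.Properties using (xor-∧-commutativeRing; ∧-comm; ∧-zeroʳ; ∧-identityʳ; xor-identityʳ; ∨-comm; T-≡)
open import Data.Empty using (⊥; ⊥-elim)
open import Data.Fin using (Fin; zero; suc; _<_; _<?_; _↑ˡ_; _↑ʳ_; splitAt)
import Data.Fin as Fin
import Data.Fin.Properties as FinP
open import Data.Integer using (ℤ; 0ℤ; 1ℤ) renaming (_+_ to _+ℤ_; _*_ to _*ℤ_)
import Data.Integer.Properties as ℤP
open import Data.List using (List; []; _∷_; map; concatMap; allFin; filterᵇ; foldr; _++_; tabulate)
open import Data.List.Properties using (map-tabulate)
open import Data.List.Membership.Propositional using (_∈_; lose)
open import Data.List.Membership.Propositional.Properties
  using (∈-allFin; ∈-map⁺; ∈-map⁻; ∈-filter⁺; ∈-filter⁻; ∈-concatMap⁺; ∈-concatMap⁻)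
open import Data.List.Relation.Unary.All as All using (All; []; _∷_)
open import Data.List.Relation.Unary.Any using (satisfied)
open import Data.Nat using (ℕ; zero; suc; _≤_; z≤n; s≤s)
open import Data.Nat.Properties using (m≤n⇒m≤1+n)
open import Data.Product using (Σ; _×_; _,_; proj₁; proj₂)
open import Data.Sum using ([_,_]′; inj₁; inj₂)
open import Function using (_∘_; Injective; Equivalence)
open import Relation.Binary using (tri<; tri≈; tri>)
open import Relation.Binary.PropositionalEquality
open import Relation.Nullary using (¬_; Dec; isYes; yes; no)
open import Relation.Nullary.Decidable using (T?)

open import Defs hiding (sym)

isYes-sound : {A : Set} (a? : Dec A) → isYes a? ≡ true → A
isYes-sound (yes a) _ = a

isYes-complete : {A : Set} (a? : Dec A) → A → isYes a? ≡ true
isYes-complete (yes _) _ = refl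
isYes-complete (no ¬a) a = ⊥-elim (¬a a)

isYes-false : {A : Set} (a? : Dec A) → ¬ A → isYes a? ≡ false
isYes-false (yes a) ¬a = ⊥-elim (¬a a)
isYes-false (no _)  _  = refl

=ᶠ-sound : ∀ {n} {a b : Fin n} → (a =ᶠ b) ≡ true → a ≡ b
=ᶠ-sound {a = a} {b} = isYes-sound (a Fin.≟ b)

=ᶠ-complete : ∀ {n} {a b : Fin n} → a ≡ b → (a =ᶠ b) ≡ true
=ᶠ-complete {a = a} {b} = isYes-complete (a Fin.≟ b)

=ᶠ-false : ∀ {n} {a b : Fin n} → ¬ a ≡ b → (a =ᶠ b) ≡ false
=ᶠ-false {a = a} {b} = isYes-false (a Fin.≟ b)

=ᶠ-refl : ∀ {n} (a : Fin n) → (a =ᶠ a) ≡ true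
=ᶠ-refl a = =ᶠ-complete refl

=ᶠ-sym : ∀ {n} (a b : Fin n) → (a =ᶠ b) ≡ (b =ᶠ a)
=ᶠ-sym a b with a Fin.≟ b
... | yes refl = sym (=ᶠ-refl a)
... | no a≢b  = sym (=ᶠ-false (a≢b ∘ sym))

=ᶠ-suc : ∀ {n} (a b : Fin n) → (suc a =ᶠ suc b) ≡ (a =ᶠ b)
=ᶠ-suc a b with a Fin.≟ b
... | yes _ = refl
... | no _  = refl

<ᶠ-sound : ∀ {n} {a b : Fin n} → (a <ᶠ b) ≡ true → a < b
<ᶠ-sound {a = a} {b} = isYes-sound (a <? b)

<ᶠ-complete : ∀ {n} {a b : Fin n} → a < b → (a <ᶠ b) ≡ true
<ᶠ-complete {a = a} {b} = isYes-complete (a <? b)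

<ᶠ-false : ∀ {n} {a b : Fin n} → ¬ a < b → (a <ᶠ b) ≡ false
<ᶠ-false {a = a} {b} = isYes-false (a <? b)

pairRow : ∀ {k} → Fin k → List (Fin k × Fin k)
pairRow {k} u = map (u ,_) (filterᵇ (u <ᶠ_) (allFin k))

∈-pairs⁻ : ∀ {k} {u v : Fin k} → (u , v) ∈ pairs k → u < v
∈-pairs⁻ {k} mem with satisfied (∈-concatMap⁻ pairRow {xs = allFin k} mem)
... | (u' , mem') with ∈-map⁻ (u' ,_) mem'
... | (v , v∈ , refl) = <ᶠ-sound (Equivalence.to T-≡ (proj₂ (∈-filter⁻ (T? ∘ (u' <ᶠ_)) {xs = allFin k} v∈)))

∈-pairs⁺ : ∀ {k} {u v : Fin k} → u < v → (u , v) ∈ pairs k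
∈-pairs⁺ {k} {u} {v} u<v =
  ∈-concatMap⁺ pairRow {xs = allFin k} (lose (∈-allFin u) (∈-map⁺ (u ,_)
    (∈-filter⁺ (T? ∘ (u <ᶠ_)) {xs = allFin k} (∈-allFin v) (Equivalence.from T-≡ (<ᶠ-complete u<v)))))

and-map⁻ : {A : Set} (f : A → Bool) (xs : List A) → and (map f xs) ≡ true → All (λ x → f x ≡ true) xs
and-map⁻ f []       _ = []
and-map⁻ f (x ∷ xs) e with f x in fx
... | true = fx ∷ and-map⁻ f xs e

and-map⁺ : {A : Set} (f : A → Bool) (xs : List A) → All (λ x → f x ≡ true) xs → and (map f xs) ≡ true
and-map⁺ f []       []         = refl
and-map⁺ f (x ∷ xs) (fx ∷ all) rewrite fx = and-map⁺ f xs all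

bool-ext : {b c : Bool} → (b ≡ true → c ≡ true) → (c ≡ true → b ≡ true) → b ≡ c
bool-ext {false} {false} _ _ = refl
bool-ext {false} {true}  _ g = g refl
bool-ext {true}  {false} f _ = sym (f refl)
bool-ext {true}  {true}  _ _ = refl

not-true : ∀ {b} → not b ≡ true → b ≡ false
not-true {false} _ = refl

∧-true : ∀ {b c} → b ∧ c ≡ true → b ≡ true × c ≡ true
∧-true {true} {true} _ = refl , refl

isInjective-separates : ∀ {n s} (f : Fin n → Fin s) → isInjective f ≡ true →
  ∀ {u v} → u < v → ¬ f u ≡ f v
isInjective-separates {n} f inj? u<v fu≡fv
  with trans (sym (not-true (All.lookup (and-map⁻ _ (pairs n) inj?) (∈-pairs⁺ u<v)))) (=ᶠ-complete fu≡fv)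
... | ()

isInjective-sound : ∀ {n s} (f : Fin n → Fin s) → isInjective f ≡ true → Injective _≡_ _≡_ f
isInjective-sound f inj? {u} {v} fu≡fv with FinP.<-cmp u v
... | tri≈ _ u≡v _ = u≡v
... | tri< u<v _ _ = ⊥-elim (isInjective-separates f inj? u<v fu≡fv)
... | tri> _ _ v<u = ⊥-elim (isInjective-separates f inj? v<u (sym fu≡fv))

isInjective-complete : ∀ {n s} (f : Fin n → Fin s) → Injective _≡_ _≡_ f → isInjective f ≡ true
isInjective-complete {n} f inj = and-map⁺ _ (pairs n) (All.tabulate λ {p} mem → separated p (∈-pairs⁻ mem))
  where
  separated : ∀ p → proj₁ p < proj₂ p → not (f (proj₁ p) =ᶠ f (proj₂ p)) ≡ true
  separated (u , v) u<v rewrite =ᶠ-false {a = f u} {f v} (λ fu≡fv → FinP.<-irrefl (inj fu≡fv) u<v) = refl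

isInjective-cong : ∀ {n s} (f g : Fin n → Fin s) → (∀ i → f i ≡ g i) → isInjective f ≡ isInjective g
isInjective-cong f g f≗g = bool-ext
  (λ f? → isInjective-complete g (λ gu≡gv → isInjective-sound f f? (trans (f≗g _) (trans gu≡gv (sym (f≗g _))))))
  (λ g? → isInjective-complete f (λ fu≡fv → isInjective-sound g g? (trans (sym (f≗g _)) (trans fu≡fv (f≗g _)))))

isInjective-∘ : ∀ {n m s} (ψ : Fin m → Fin s) (g : Fin n → Fin m) → Injective _≡_ _≡_ ψ →
  isInjective (ψ ∘ g) ≡ isInjective g
isInjective-∘ ψ g ψ-inj = bool-ext
  (λ ψg? → isInjective-complete g (λ gu≡gv → isInjective-sound (ψ ∘ g) ψg? (cong ψ gu≡gv)))
  (λ g? → isInjective-complete (ψ ∘ g) (λ ψgu≡ψgv → isInjective-sound g g? (ψ-inj ψgu≡ψgv)))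

avoids : ∀ {k s} → Fin s → (Fin k → Fin s) → Bool
avoids {zero}  a f = true
avoids {suc k} a f = not (f zero =ᶠ a) ∧ avoids a (f ∘ suc)

avoids-sound : ∀ {k s} (a : Fin s) (f : Fin k → Fin s) → avoids a f ≡ true → ∀ j → ¬ f j ≡ a
avoids-sound {suc k} a f av zero fj≡a with trans (sym (not-true (proj₁ (∧-true {not (f zero =ᶠ a)} av)))) (=ᶠ-complete fj≡a)
... | ()
avoids-sound {suc k} a f av (suc j) = avoids-sound a (f ∘ suc) (proj₂ (∧-true {not (f zero =ᶠ a)} av)) j

avoids-complete : ∀ {k s} (a : Fin s) (f : Fin k → Fin s) → (∀ j → ¬ f j ≡ a) → avoids a f ≡ true
avoids-complete {zero}  a f _    = refl
avoids-complete {suc k} a f miss rewrite =ᶠ-false (miss zero) = avoids-complete a (f ∘ suc) (miss ∘ suc)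

isInjective-consF : ∀ {k s} (a : Fin s) (f : Fin k → Fin s) →
  isInjective (consF a f) ≡ avoids a f ∧ isInjective f
isInjective-consF a f = bool-ext to from
  where
  to : isInjective (consF a f) ≡ true → avoids a f ∧ isInjective f ≡ true
  to af? with isInjective-sound (consF a f) af?
  ... | af-inj rewrite avoids-complete a f (λ j fj≡a → FinP.0≢1+n (af-inj (sym fj≡a)))
                     | isInjective-complete f (λ fu≡fv → FinP.suc-injective (af-inj fu≡fv)) = refl
  from : avoids a f ∧ isInjective f ≡ true → isInjective (consF a f) ≡ true
  from av∧f? = isInjective-complete (consF a f) af-inj
    where
    av : avoids a f ≡ true
    av = proj₁ (∧-true {avoids a f} av∧f?)
    f? : isInjective f ≡ true
    f? = proj₂ (∧-true {avoids a f} av∧f?)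
    af-inj : Injective _≡_ _≡_ (consF a f)
    af-inj {zero}  {zero}  _ = refl
    af-inj {zero}  {suc v} a≡fv = ⊥-elim (avoids-sound a f av v (sym a≡fv))
    af-inj {suc u} {zero}  fu≡a = ⊥-elim (avoids-sound a f av u fu≡a)
    af-inj {suc u} {suc v} fu≡fv = cong suc (isInjective-sound f f? fu≡fv)

-- The two rings used
-- below (ℤ, and the field 𝔽₂ realised as (Bool, xor, ∧)) both have
-- propositional equality as their equivalence, which lets the sums be
-- manipulated with ordinary ≡-reasoning.
module FiniteSums (R : CommutativeRing 0ℓ 0ℓ)
  (≈⇒≡ : ∀ {x y} → CommutativeRing._≈_ R x y → x ≡ y) where

  open CommutativeRing R using (Carrier; _+_; _*_; 0#; 1#)
  private module R = CommutativeRing R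
  open ≡-Reasoning

  -- ∑ xs g is g x₁ + (g x₂ + (⋯ + 0)); coeff and monOf in Defs are
  -- definitionally sums of this shape.
  ∑ : {A : Set} → List A → (A → Carrier) → Carrier
  ∑ xs g = foldr (λ x acc → g x + acc) 0# xs

  ⟦_⟧ : Bool → Carrier
  ⟦ b ⟧ = if b then 1# else 0#

  +-assoc : ∀ x y z → (x + y) + z ≡ x + (y + z)
  +-assoc x y z = ≈⇒≡ (R.+-assoc x y z)

  +-comm : ∀ x y → x + y ≡ y + x
  +-comm x y = ≈⇒≡ (R.+-comm x y)

  +-identityˡ : ∀ x → 0# + x ≡ x
  +-identityˡ x = ≈⇒≡ (R.+-identityˡ x)

  +-identityʳ : ∀ x → x + 0# ≡ x
  +-identityʳ x = ≈⇒≡ (R.+-identityʳ x)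

  *-identityˡ : ∀ x → 1# * x ≡ x
  *-identityˡ x = ≈⇒≡ (R.*-identityˡ x)

  *-zeroˡ : ∀ x → 0# * x ≡ 0#
  *-zeroˡ x = ≈⇒≡ (R.zeroˡ x)

  *-comm : ∀ x y → x * y ≡ y * x
  *-comm x y = ≈⇒≡ (R.*-comm x y)

  *-assoc : ∀ x y z → (x * y) * z ≡ x * (y * z)
  *-assoc x y z = ≈⇒≡ (R.*-assoc x y z)

  *-distribʳ : ∀ x y z → (y + z) * x ≡ y * x + z * x
  *-distribʳ x y z = ≈⇒≡ (R.distribʳ x y z)

  +-interchange : ∀ a b c d → (a + b) + (c + d) ≡ (a + c) + (b + d)
  +-interchange a b c d = begin
    (a + b) + (c + d) ≡⟨ +-assoc a b (c + d) ⟩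
    a + (b + (c + d)) ≡⟨ cong (a +_) (sym (+-assoc b c d)) ⟩
    a + ((b + c) + d) ≡⟨ cong (λ t → a + (t + d)) (+-comm b c) ⟩
    a + ((c + b) + d) ≡⟨ cong (a +_) (+-assoc c b d) ⟩
    a + (c + (b + d)) ≡⟨ sym (+-assoc a c (b + d)) ⟩
    (a + c) + (b + d) ∎

  ⟦∧⟧ : ∀ a b → ⟦ a ∧ b ⟧ ≡ ⟦ a ⟧ * ⟦ b ⟧
  ⟦∧⟧ false b = sym (*-zeroˡ _)
  ⟦∧⟧ true  b = sym (*-identityˡ _)

  ∑-cong : {A : Set} (xs : List A) {g h : A → Carrier} → (∀ x → g x ≡ h x) → ∑ xs g ≡ ∑ xs h
  ∑-cong []       g≗h = refl
  ∑-cong (x ∷ xs) g≗h = cong₂ _+_ (g≗h x) (∑-cong xs g≗h)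

  ∑-zero : {A : Set} (xs : List A) → ∑ xs (λ _ → 0#) ≡ 0#
  ∑-zero []       = refl
  ∑-zero (x ∷ xs) = trans (cong (0# +_) (∑-zero xs)) (+-identityˡ 0#)

  ∑-++ : {A : Set} (xs ys : List A) (g : A → Carrier) → ∑ (xs ++ ys) g ≡ ∑ xs g + ∑ ys g
  ∑-++ []       ys g = sym (+-identityˡ _)
  ∑-++ (x ∷ xs) ys g = trans (cong (g x +_) (∑-++ xs ys g)) (sym (+-assoc _ _ _))

  ∑-map : {A B : Set} (f : A → B) (xs : List A) (g : B → Carrier) → ∑ (map f xs) g ≡ ∑ xs (g ∘ f)
  ∑-map f []       g = refl
  ∑-map f (x ∷ xs) g = cong (g (f x) +_) (∑-map f xs g)

  ∑-concatMap : {A B : Set} (f : A → List B) (xs : List A) (g : B → Carrier) →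
    ∑ (concatMap f xs) g ≡ ∑ xs (λ x → ∑ (f x) g)
  ∑-concatMap f []       g = refl
  ∑-concatMap f (x ∷ xs) g =
    trans (∑-++ (f x) (concatMap f xs) g) (cong (∑ (f x) g +_) (∑-concatMap f xs g))

  ∑-+ : {A : Set} (xs : List A) (g h : A → Carrier) → ∑ xs (λ x → g x + h x) ≡ ∑ xs g + ∑ xs h
  ∑-+ []       g h = sym (+-identityˡ 0#)
  ∑-+ (x ∷ xs) g h = trans (cong (g x + h x +_) (∑-+ xs g h)) (+-interchange _ _ _ _)

  ∑-*ʳ : {A : Set} (xs : List A) (c : Carrier) (g : A → Carrier) → ∑ xs (λ x → g x * c) ≡ ∑ xs g * c
  ∑-*ʳ []       c g = sym (*-zeroˡ c)
  ∑-*ʳ (x ∷ xs) c g = trans (cong (g x * c +_) (∑-*ʳ xs c g)) (sym (*-distribʳ c _ _))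

  ∑-*ˡ : {A : Set} (xs : List A) (c : Carrier) (g : A → Carrier) → ∑ xs (λ x → c * g x) ≡ c * ∑ xs g
  ∑-*ˡ xs c g = trans (∑-cong xs (λ x → *-comm c (g x))) (trans (∑-*ʳ xs c g) (*-comm _ c))

  ∑-swap : {A B : Set} (xs : List A) (ys : List B) (g : A → B → Carrier) →
    ∑ xs (λ x → ∑ ys (g x)) ≡ ∑ ys (λ y → ∑ xs (λ x → g x y))
  ∑-swap []       ys g = sym (∑-zero ys)
  ∑-swap (x ∷ xs) ys g = begin
    ∑ ys (g x) + ∑ xs (λ x' → ∑ ys (g x'))          ≡⟨ cong (∑ ys (g x) +_) (∑-swap xs ys g) ⟩
    ∑ ys (g x) + ∑ ys (λ y → ∑ xs (λ x' → g x' y))  ≡⟨ sym (∑-+ ys (g x) _) ⟩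
    ∑ ys (λ y → g x y + ∑ xs (λ x' → g x' y))       ∎

  ∑-filter : {A : Set} (p : A → Bool) (xs : List A) (g : A → Carrier) →
    ∑ (filterᵇ p xs) g ≡ ∑ xs (λ x → ⟦ p x ⟧ * g x)
  ∑-filter p []       g = refl
  ∑-filter p (x ∷ xs) g with p x
  ... | true  = cong₂ _+_ (sym (*-identityˡ (g x))) (∑-filter p xs g)
  ... | false = begin
    ∑ (filterᵇ p xs) g                    ≡⟨ ∑-filter p xs g ⟩
    ∑ xs (λ x → ⟦ p x ⟧ * g x)            ≡⟨ sym (+-identityˡ _) ⟩
    0# + ∑ xs (λ x → ⟦ p x ⟧ * g x)       ≡⟨ cong (_+ ∑ xs (λ x → ⟦ p x ⟧ * g x)) (sym (*-zeroˡ (g x))) ⟩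
    0# * g x + ∑ xs (λ x → ⟦ p x ⟧ * g x) ∎

  ∑-filter-cong : {A : Set} (p : A → Bool) (xs : List A) {g h : A → Carrier} →
    (∀ x → p x ≡ true → g x ≡ h x) → ∑ (filterᵇ p xs) g ≡ ∑ (filterᵇ p xs) h
  ∑-filter-cong p xs {g} {h} g≗h = begin
    ∑ (filterᵇ p xs) g         ≡⟨ ∑-filter p xs g ⟩
    ∑ xs (λ x → ⟦ p x ⟧ * g x) ≡⟨ ∑-cong xs pointwise ⟩
    ∑ xs (λ x → ⟦ p x ⟧ * h x) ≡⟨ sym (∑-filter p xs h) ⟩
    ∑ (filterᵇ p xs) h         ∎
    where
    pointwise : ∀ x → ⟦ p x ⟧ * g x ≡ ⟦ p x ⟧ * h x
    pointwise x with p x in px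
    ... | true  = cong (1# *_) (g≗h x px)
    ... | false = trans (*-zeroˡ _) (sym (*-zeroˡ _))

  ∑-allFin-suc : (n : ℕ) (g : Fin (suc n) → Carrier) →
    ∑ (allFin (suc n)) g ≡ g zero + ∑ (allFin n) (g ∘ suc)
  ∑-allFin-suc n g = cong (g zero +_) (begin
    ∑ (tabulate suc) g      ≡⟨ cong (λ xs → ∑ xs g) (sym (map-tabulate (λ i → i) suc)) ⟩
    ∑ (map suc (allFin n)) g          ≡⟨ ∑-map suc (allFin n) g ⟩
    ∑ (allFin n) (g ∘ suc)            ∎)

  ∑-δ : (n : ℕ) (b : Fin n) (g : Fin n → Carrier) → ∑ (allFin n) (λ a → ⟦ b =ᶠ a ⟧ * g a) ≡ g b
  ∑-δ (suc n) zero g = begin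
    ∑ (allFin (suc n)) (λ a → ⟦ zero =ᶠ a ⟧ * g a)
      ≡⟨ ∑-allFin-suc n _ ⟩
    1# * g zero + ∑ (allFin n) (λ a → 0# * g (suc a))
      ≡⟨ cong₂ _+_ (*-identityˡ _) (trans (∑-cong (allFin n) (λ a → *-zeroˡ _)) (∑-zero (allFin n))) ⟩
    g zero + 0#
      ≡⟨ +-identityʳ _ ⟩
    g zero ∎
  ∑-δ (suc n) (suc b) g = begin
    ∑ (allFin (suc n)) (λ a → ⟦ suc b =ᶠ a ⟧ * g a)
      ≡⟨ ∑-allFin-suc n _ ⟩
    0# * g zero + ∑ (allFin n) (λ a → ⟦ suc b =ᶠ suc a ⟧ * g (suc a))
      ≡⟨ cong₂ _+_ (*-zeroˡ _) (∑-cong (allFin n) (λ a → cong (λ t → ⟦ t ⟧ * g (suc a)) (=ᶠ-suc b a))) ⟩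
    0# + ∑ (allFin n) (λ a → ⟦ b =ᶠ a ⟧ * g (suc a))
      ≡⟨ +-identityˡ _ ⟩
    ∑ (allFin n) (λ a → ⟦ b =ᶠ a ⟧ * g (suc a))
      ≡⟨ ∑-δ n b (g ∘ suc) ⟩
    g (suc b) ∎

  ∑-pairs : (k : ℕ) (g : Fin k × Fin k → Carrier) →
    ∑ (pairs k) g ≡ ∑ (allFin k) (λ u → ∑ (allFin k) (λ v → ⟦ u <ᶠ v ⟧ * g (u , v)))
  ∑-pairs k g = trans (∑-concatMap _ (allFin k) g) (∑-cong (allFin k) (λ u →
    trans (∑-map (u ,_) (filterᵇ (u <ᶠ_) (allFin k)) g) (∑-filter (u <ᶠ_) (allFin k) (λ v → g (u , v)))))

  ∑∑-filter : {A B : Set} (p : A → Bool) (q : B → Bool) (xs : List A) (ys : List B) (g : A → B → Carrier) →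
    ∑ (filterᵇ p xs) (λ x → ∑ (filterᵇ q ys) (g x)) ≡ ∑ xs (λ x → ∑ ys (λ y → ⟦ p x ∧ q y ⟧ * g x y))
  ∑∑-filter p q xs ys g = begin
    ∑ (filterᵇ p xs) (λ x → ∑ (filterᵇ q ys) (g x))
      ≡⟨ ∑-filter p xs _ ⟩
    ∑ xs (λ x → ⟦ p x ⟧ * ∑ (filterᵇ q ys) (g x))
      ≡⟨ ∑-cong xs (λ x → cong (⟦ p x ⟧ *_) (∑-filter q ys (g x))) ⟩
    ∑ xs (λ x → ⟦ p x ⟧ * ∑ ys (λ y → ⟦ q y ⟧ * g x y))
      ≡⟨ ∑-cong xs (λ x → sym (∑-*ˡ ys ⟦ p x ⟧ _)) ⟩
    ∑ xs (λ x → ∑ ys (λ y → ⟦ p x ⟧ * (⟦ q y ⟧ * g x y)))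
      ≡⟨ ∑-cong xs (λ x → ∑-cong ys (λ y → trans (sym (*-assoc _ _ _)) (cong (_* g x y) (sym (⟦∧⟧ (p x) (q y)))))) ⟩
    ∑ xs (λ x → ∑ ys (λ y → ⟦ p x ∧ q y ⟧ * g x y)) ∎

-- A pattern p : Pattern k m is a surjection Fin k ↠ Fin m in canonical
-- form, i.e. a set partition of Fin k into m labelled blocks.  It is
-- built point by point: the new point 0 either opens a new block (block 0,
-- the old labels shifted up) or joins an existing block j.
data Pattern : ℕ → ℕ → Set where
  []    : Pattern 0 0
  fresh : ∀ {k m} → Pattern k m → Pattern (suc k) (suc m)
  join  : ∀ {k m} → Fin m → Pattern k m → Pattern (suc k) m

collapse : ∀ {k m} → Pattern k m → Fin k → Fin m
collapse []         = λ ()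
collapse (fresh p)  = consF zero (suc ∘ collapse p)
collapse (join j p) = consF j (collapse p)

pattern-size : ∀ {k m} → Pattern k m → m ≤ k
pattern-size []         = z≤n
pattern-size (fresh p)  = s≤s (pattern-size p)
pattern-size (join j p) = m≤n⇒m≤1+n (pattern-size p)

SomePattern : ℕ → Set
SomePattern k = Σ ℕ (Pattern k)

extend : ∀ {k} → SomePattern k → List (SomePattern (suc k))
extend (m , p) = (suc m , fresh p) ∷ map (λ j → (m , join j p)) (allFin m)

patterns : (k : ℕ) → List (SomePattern k)
patterns zero    = (0 , []) ∷ []
patterns (suc k) = concatMap extend (patterns k)

consF-cong : ∀ {n s} (a : Fin s) {f g : Fin n → Fin s} → (∀ i → f i ≡ g i) → ∀ i → consF a f i ≡ consF a g i
consF-cong a f≗g zero    = refl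
consF-cong a f≗g (suc i) = f≗g i

module MapSums (R : CommutativeRing 0ℓ 0ℓ)
  (≈⇒≡ : ∀ {x y} → CommutativeRing._≈_ R x y → x ≡ y) where

  open CommutativeRing R using (Carrier; _+_; _*_; 0#; 1#)
  open FiniteSums R ≈⇒≡
  open ≡-Reasoning

  Extensional : ∀ {k s} → ((Fin k → Fin s) → Carrier) → Set
  Extensional {k} {s} G = ∀ {f g} → (∀ i → f i ≡ g i) → G f ≡ G g

  ∑maps-suc : ∀ k s (G : (Fin (suc k) → Fin s) → Carrier) →
    ∑ (allMaps (suc k) s) G ≡ ∑ (allMaps k s) (λ f → ∑ (allFin s) (λ a → G (consF a f)))
  ∑maps-suc k s G = trans (∑-concatMap _ (allMaps k s) G)
    (∑-cong (allMaps k s) (λ f → ∑-map (λ a → consF a f) (allFin s) G))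

  ∑inj-suc : ∀ m s (F : (Fin (suc m) → Fin s) → Carrier) →
    ∑ (inj (suc m) s) F ≡ ∑ (inj m s) (λ ψ → ∑ (allFin s) (λ a → ⟦ avoids a ψ ⟧ * F (consF a ψ)))
  ∑inj-suc m s F = begin
    ∑ (inj (suc m) s) F
      ≡⟨ ∑-filter isInjective (allMaps (suc m) s) F ⟩
    ∑ (allMaps (suc m) s) (λ φ → ⟦ isInjective φ ⟧ * F φ)
      ≡⟨ ∑maps-suc m s _ ⟩
    ∑ (allMaps m s) (λ f → ∑ (allFin s) (λ a → ⟦ isInjective (consF a f) ⟧ * F (consF a f)))
      ≡⟨ ∑-cong (allMaps m s) (λ f → ∑-cong (allFin s) (λ a → split-indicator f a)) ⟩
    ∑ (allMaps m s) (λ f → ∑ (allFin s) (λ a → ⟦ isInjective f ⟧ * (⟦ avoids a f ⟧ * F (consF a f))))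
      ≡⟨ ∑-cong (allMaps m s) (λ f → ∑-*ˡ (allFin s) _ _) ⟩
    ∑ (allMaps m s) (λ f → ⟦ isInjective f ⟧ * ∑ (allFin s) (λ a → ⟦ avoids a f ⟧ * F (consF a f)))
      ≡⟨ sym (∑-filter isInjective (allMaps m s) _) ⟩
    ∑ (inj m s) (λ ψ → ∑ (allFin s) (λ a → ⟦ avoids a ψ ⟧ * F (consF a ψ))) ∎
    where
    split-indicator : ∀ f a → ⟦ isInjective (consF a f) ⟧ * F (consF a f) ≡
                              ⟦ isInjective f ⟧ * (⟦ avoids a f ⟧ * F (consF a f))
    split-indicator f a rewrite isInjective-consF a f | ⟦∧⟧ (avoids a f) (isInjective f)
      | *-comm ⟦ avoids a f ⟧ ⟦ isInjective f ⟧ = *-assoc _ _ _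

  split-by : ∀ (b c : Bool) (X : Carrier) → ⟦ c ⟧ * X ≡ ⟦ b ⟧ * (⟦ c ⟧ * X) + ⟦ not b ∧ c ⟧ * X
  split-by true  c X = trans (sym (+-identityʳ _)) (cong₂ _+_ (sym (*-identityˡ _)) (sym (*-zeroˡ X)))
  split-by false c X = trans (sym (+-identityˡ _)) (cong (_+ ⟦ c ⟧ * X) (sym (*-zeroˡ _)))

  ∑-image-split : ∀ m s (ψ : Fin m → Fin s) → Injective _≡_ _≡_ ψ → (H : Fin s → Carrier) →
    ∑ (allFin s) H ≡ ∑ (allFin m) (H ∘ ψ) + ∑ (allFin s) (λ a → ⟦ avoids a ψ ⟧ * H a)
  ∑-image-split zero    s ψ ψ-inj H = trans (∑-cong (allFin s) (λ a → sym (*-identityˡ (H a)))) (sym (+-identityˡ _))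
  ∑-image-split (suc m) s ψ ψ-inj H = begin
    ∑ (allFin s) H
      ≡⟨ ∑-image-split m s (ψ ∘ suc) (FinP.suc-injective ∘ ψ-inj) H ⟩
    A + ∑ (allFin s) (λ a → ⟦ avoidsTail a ⟧ * H a)
      ≡⟨ cong (A +_) (∑-cong (allFin s) (λ a → split-by (ψ zero =ᶠ a) (avoidsTail a) (H a))) ⟩
    A + ∑ (allFin s) (λ a → ⟦ ψ zero =ᶠ a ⟧ * (⟦ avoidsTail a ⟧ * H a) + ⟦ avoids a ψ ⟧ * H a)
      ≡⟨ cong (A +_) (∑-+ (allFin s) _ _) ⟩
    A + (∑ (allFin s) (λ a → ⟦ ψ zero =ᶠ a ⟧ * (⟦ avoidsTail a ⟧ * H a)) + B)
      ≡⟨ cong (λ t → A + (t + B)) (∑-δ s (ψ zero) (λ a → ⟦ avoidsTail a ⟧ * H a)) ⟩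
    A + (⟦ avoidsTail (ψ zero) ⟧ * H (ψ zero) + B)
      ≡⟨ cong (λ t → A + (⟦ t ⟧ * H (ψ zero) + B)) ψ0-new ⟩
    A + (1# * H (ψ zero) + B)
      ≡⟨ cong (λ t → A + (t + B)) (*-identityˡ _) ⟩
    A + (H (ψ zero) + B)
      ≡⟨ sym (+-assoc _ _ _) ⟩
    (A + H (ψ zero)) + B
      ≡⟨ cong (_+ B) (trans (+-comm A _) (sym (∑-allFin-suc m (H ∘ ψ)))) ⟩
    ∑ (allFin (suc m)) (H ∘ ψ) + B ∎
    where
    A B : Carrier
    A = ∑ (allFin m) (H ∘ ψ ∘ suc)
    B = ∑ (allFin s) (λ a → ⟦ avoids a ψ ⟧ * H a)
    avoidsTail : Fin s → Bool
    avoidsTail a = avoids a (ψ ∘ suc)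
    ψ0-new : avoidsTail (ψ zero) ≡ true
    ψ0-new = avoids-complete (ψ zero) (ψ ∘ suc) (λ j ψj≡ψ0 → FinP.0≢1+n (ψ-inj (sym ψj≡ψ0)))

  patternTerm : ∀ {k s} → ((Fin k → Fin s) → Carrier) → SomePattern k → Carrier
  patternTerm {s = s} G (m , p) = ∑ (inj m s) (λ ψ → G (ψ ∘ collapse p))

  -- one more point: its value is either new (a fresh block) or the value of an existing block
  patternTerm-extend : ∀ {k s} (G : (Fin (suc k) → Fin s) → Carrier) → Extensional G → (mp : SomePattern k) →
    ∑ (inj (proj₁ mp) s) (λ ψ → ∑ (allFin s) (λ a → G (consF a (ψ ∘ collapse (proj₂ mp))))) ≡
    ∑ (extend mp) (patternTerm G)
  patternTerm-extend {k} {s} G G-ext (m , p) = begin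
    ∑ (inj m s) (λ ψ → ∑ (allFin s) (λ a → G (consF a (ψ ∘ collapse p))))
      ≡⟨ ∑-filter-cong isInjective (allMaps m s) (λ ψ ψ? →
           trans (∑-image-split m s ψ (isInjective-sound ψ ψ?) (λ a → G (consF a (ψ ∘ collapse p))))
                 (+-comm _ _)) ⟩
    ∑ (inj m s) (λ ψ → New ψ + Old ψ)
      ≡⟨ ∑-+ (inj m s) New Old ⟩
    ∑ (inj m s) New + ∑ (inj m s) Old
      ≡⟨ cong₂ _+_ (sym fresh-block) old-block ⟩
    patternTerm G (suc m , fresh p) + ∑ (map (λ j → (m , join j p)) (allFin m)) (patternTerm G) ∎
    where
    New Old : (Fin m → Fin s) → Carrier
    New ψ = ∑ (allFin s) (λ a → ⟦ avoids a ψ ⟧ * G (consF a (ψ ∘ collapse p)))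
    Old ψ = ∑ (allFin m) (λ j → G (consF (ψ j) (ψ ∘ collapse p)))

    fresh-block : patternTerm G (suc m , fresh p) ≡ ∑ (inj m s) New
    fresh-block = trans (∑inj-suc m s _) (∑-cong (inj m s) (λ ψ → ∑-cong (allFin s) (λ a →
      cong (⟦ avoids a ψ ⟧ *_) (G-ext λ { zero → refl ; (suc i) → refl }))))

    old-block : ∑ (inj m s) Old ≡ ∑ (map (λ j → (m , join j p)) (allFin m)) (patternTerm G)
    old-block = begin
      ∑ (inj m s) Old
        ≡⟨ ∑-cong (inj m s) (λ ψ → ∑-cong (allFin m) (λ j → G-ext λ { zero → refl ; (suc i) → refl })) ⟩
      ∑ (inj m s) (λ ψ → ∑ (allFin m) (λ j → G (ψ ∘ collapse (join j p))))
        ≡⟨ ∑-swap (inj m s) (allFin m) _ ⟩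
      ∑ (allFin m) (λ j → patternTerm G (m , join j p))
        ≡⟨ sym (∑-map (λ j → (m , join j p)) (allFin m) (patternTerm G)) ⟩
      ∑ (map (λ j → (m , join j p)) (allFin m)) (patternTerm G) ∎

  -- Every map factors uniquely as an injection after the collapse of a pattern.
  ∑maps-by-pattern : ∀ k s (G : (Fin k → Fin s) → Carrier) → Extensional G →
    ∑ (allMaps k s) G ≡ ∑ (patterns k) (patternTerm G)
  ∑maps-by-pattern zero    s G G-ext = cong (_+ 0#) (trans (G-ext (λ ())) (sym (+-identityʳ _)))
  ∑maps-by-pattern (suc k) s G G-ext = begin
    ∑ (allMaps (suc k) s) G
      ≡⟨ ∑maps-suc k s G ⟩
    ∑ (allMaps k s) G⁺
      ≡⟨ ∑maps-by-pattern k s G⁺ (λ f≗g → ∑-cong (allFin s) (λ a → G-ext (consF-cong a f≗g))) ⟩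
    ∑ (patterns k) (patternTerm G⁺)
      ≡⟨ ∑-cong (patterns k) (patternTerm-extend G G-ext) ⟩
    ∑ (patterns k) (λ mp → ∑ (extend mp) (patternTerm G))
      ≡⟨ sym (∑-concatMap extend (patterns k) (patternTerm G)) ⟩
    ∑ (patterns (suc k)) (patternTerm G) ∎
    where
    G⁺ : (Fin k → Fin s) → Carrier
    G⁺ f = ∑ (allFin s) (λ a → G (consF a f))

-- Sums in 𝔽₂ = (Bool, xor, ∧): monOf in Defs is such a sum.
module 𝔽₂ = FiniteSums xor-∧-commutativeRing (λ e → e)
open 𝔽₂ using () renaming (∑ to ∑₂)

⟦⟧₂-id : ∀ b → 𝔽₂.⟦ b ⟧ ≡ b
⟦⟧₂-id true  = refl
⟦⟧₂-id false = refl

∑₂-δ : (n : ℕ) (b : Fin n) (g : Fin n → Bool) → ∑₂ (allFin n) (λ a → (b =ᶠ a) ∧ g a) ≡ g b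
∑₂-δ n b g = trans (𝔽₂.∑-cong (allFin n) (λ a → cong (_∧ g a) (sym (⟦⟧₂-id (b =ᶠ a))))) (𝔽₂.∑-δ n b g)

∨-as-xor : ∀ x y → (x ≡ true → y ≡ true → ⊥) → x ∨ y ≡ x xor y
∨-as-xor false y     _      = refl
∨-as-xor true  false _      = refl
∨-as-xor true  true  excl = ⊥-elim (excl refl refl)

hits-swapEnds : ∀ {s} (c d x y : Fin s) → hits c d x y ≡ hits d c x y
hits-swapEnds c d x y = ∨-comm ((x =ᶠ c) ∧ (y =ᶠ d)) ((x =ᶠ d) ∧ (y =ᶠ c))

hits-swapArgs : ∀ {s} (c d x y : Fin s) → hits c d y x ≡ hits c d x y
hits-swapArgs c d x y rewrite ∧-comm (y =ᶠ c) (x =ᶠ d) | ∧-comm (y =ᶠ d) (x =ᶠ c) =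
  ∨-comm ((x =ᶠ d) ∧ (y =ᶠ c)) ((x =ᶠ c) ∧ (y =ᶠ d))

hits-loop : ∀ {s} (c d x : Fin s) → ¬ c ≡ d → hits c d x x ≡ false
hits-loop c d x c≢d with x =ᶠ c in x≡c | x =ᶠ d in x≡d
... | true  | true  = ⊥-elim (c≢d (trans (sym (=ᶠ-sound x≡c)) (=ᶠ-sound x≡d)))
... | true  | false = refl
... | false | true  = refl
... | false | false = refl

hits-as-xor : ∀ {m} (u v x y : Fin m) → ¬ u ≡ v →
  hits u v x y ≡ ((x =ᶠ u) ∧ (y =ᶠ v)) xor ((y =ᶠ u) ∧ (x =ᶠ v))
hits-as-xor u v x y u≢v = trans
  (∨-as-xor ((x =ᶠ u) ∧ (y =ᶠ v)) ((x =ᶠ v) ∧ (y =ᶠ u)) exclusive)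
  (cong (((x =ᶠ u) ∧ (y =ᶠ v)) xor_) (∧-comm (x =ᶠ v) (y =ᶠ u)))
  where
  exclusive : (x =ᶠ u) ∧ (y =ᶠ v) ≡ true → (x =ᶠ v) ∧ (y =ᶠ u) ≡ true → ⊥
  exclusive xu∧yv xv∧yu =
    u≢v (trans (sym (=ᶠ-sound {a = x} (proj₁ (∧-true {x =ᶠ u} xu∧yv))))
               (=ᶠ-sound {a = x} (proj₁ (∧-true {x =ᶠ v} xv∧yu))))

edgeParity : ∀ {m} → List (Fin m × Fin m) → Fin m → Fin m → Bool
edgeParity L c d = if c =ᶠ d then false else ∑₂ L (λ xy → hits c d (proj₁ xy) (proj₂ xy))

edgeParity-sym : ∀ {m} (L : List (Fin m × Fin m)) c d → edgeParity L c d ≡ edgeParity L d c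
edgeParity-sym L c d rewrite =ᶠ-sym c d with d =ᶠ c
... | true  = refl
... | false = 𝔽₂.∑-cong L (λ xy → hits-swapEnds c d (proj₁ xy) (proj₂ xy))

edgeParity-irrefl : ∀ {m} (L : List (Fin m × Fin m)) c → edgeParity L c c ≡ false
edgeParity-irrefl L c rewrite =ᶠ-refl c = refl

graphOf : ∀ {m} → List (Fin m × Fin m) → Graph m
graphOf L = record { adj = edgeParity L ; sym = edgeParity-sym L ; irrefl = edgeParity-irrefl L }

∑₂-δδ : ∀ {m} (x y : Fin m) (g : Fin m → Fin m → Bool) →
  ∑₂ (allFin m) (λ u → ∑₂ (allFin m) (λ v → (x =ᶠ u) ∧ ((y =ᶠ v) ∧ g u v))) ≡ g x y
∑₂-δδ {m} x y g = trans
  (𝔽₂.∑-cong (allFin m) (λ u → trans (𝔽₂.∑-*ˡ (allFin m) (x =ᶠ u) _) (cong ((x =ᶠ u) ∧_) (∑₂-δ m y (g u)))))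
  (∑₂-δ m x (λ u → g u y))

hits-∧-split : ∀ {m} (u v x y : Fin m) (k : Bool) → (k ≡ true → ¬ u ≡ v) →
  hits u v x y ∧ k ≡ ((x =ᶠ u) ∧ ((y =ᶠ v) ∧ k)) xor ((y =ᶠ u) ∧ ((x =ᶠ v) ∧ k))
hits-∧-split u v x y false _
  rewrite ∧-zeroʳ (hits u v x y) | ∧-zeroʳ (y =ᶠ v) | ∧-zeroʳ (x =ᶠ u) | ∧-zeroʳ (x =ᶠ v) | ∧-zeroʳ (y =ᶠ u) = refl
hits-∧-split u v x y true proper
  rewrite ∧-identityʳ (hits u v x y) | ∧-identityʳ (y =ᶠ v) | ∧-identityʳ (x =ᶠ v) = hits-as-xor u v x y (proper refl)

module EdgeListMonomial {m s : ℕ} (ψ : Fin m → Fin s) {a b : Fin s} (a≢b : ¬ a ≡ b) where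

  H : Fin m → Fin m → Bool
  H c d = hits a b (ψ c) (ψ d)

  K : Fin m → Fin m → Bool
  K u v = (u <ᶠ v) ∧ H u v

  K-proper : ∀ u v → K u v ≡ true → ¬ u ≡ v
  K-proper u v Kuv refl = FinP.<-irrefl refl (<ᶠ-sound (proj₁ (∧-true {u <ᶠ v} Kuv)))

  -- every unordered pair is read exactly once, and loops do not hit {a, b}
  K-symmetrised : ∀ x y → K x y xor K y x ≡ H x y
  K-symmetrised x y with FinP.<-cmp x y
  ... | tri< x<y _ y≮x rewrite <ᶠ-complete x<y | <ᶠ-false y≮x = xor-identityʳ _
  ... | tri> x≮y _ y<x rewrite <ᶠ-complete y<x | <ᶠ-false x≮y = hits-swapArgs a b (ψ x) (ψ y)
  ... | tri≈ x≮y refl _ rewrite <ᶠ-false x≮y = sym (hits-loop a b (ψ x) a≢b)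

  edge-term : ∀ (L : List (Fin m × Fin m)) u v →
    𝔽₂.⟦ u <ᶠ v ⟧ ∧ (𝔽₂.⟦ edgeParity L u v ⟧ ∧ H u v) ≡
    ∑₂ L (λ xy → hits u v (proj₁ xy) (proj₂ xy) ∧ K u v)
  edge-term L u v rewrite ⟦⟧₂-id (u <ᶠ v) | ⟦⟧₂-id (edgeParity L u v)
    | 𝔽₂.∑-*ʳ L (K u v) (λ xy → hits u v (proj₁ xy) (proj₂ xy)) with u <ᶠ v in u<v
  ... | false = sym (∧-zeroʳ _)
  ... | true rewrite =ᶠ-false (λ u≡v → FinP.<-irrefl u≡v (<ᶠ-sound u<v)) = refl

  pair-term : ∀ x y → ∑₂ (allFin m) (λ u → ∑₂ (allFin m) (λ v → hits u v x y ∧ K u v)) ≡ H x y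
  pair-term x y = begin
    ∑₂ (allFin m) (λ u → ∑₂ (allFin m) (λ v → hits u v x y ∧ K u v))
      ≡⟨ 𝔽₂.∑-cong (allFin m) (λ u → 𝔽₂.∑-cong (allFin m) (λ v → hits-∧-split u v x y (K u v) (K-proper u v))) ⟩
    ∑₂ (allFin m) (λ u → ∑₂ (allFin m) (λ v → Direct u v xor Reversed u v))
      ≡⟨ 𝔽₂.∑-cong (allFin m) (λ u → 𝔽₂.∑-+ (allFin m) (Direct u) (Reversed u)) ⟩
    ∑₂ (allFin m) (λ u → ∑₂ (allFin m) (Direct u) xor ∑₂ (allFin m) (Reversed u))
      ≡⟨ 𝔽₂.∑-+ (allFin m) (λ u → ∑₂ (allFin m) (Direct u)) (λ u → ∑₂ (allFin m) (Reversed u)) ⟩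
    ∑₂ (allFin m) (λ u → ∑₂ (allFin m) (Direct u)) xor ∑₂ (allFin m) (λ u → ∑₂ (allFin m) (Reversed u))
      ≡⟨ cong₂ _xor_ (∑₂-δδ x y K) (∑₂-δδ y x K) ⟩
    K x y xor K y x
      ≡⟨ K-symmetrised x y ⟩
    H x y ∎
    where
    open ≡-Reasoning
    Direct Reversed : Fin m → Fin m → Bool
    Direct   u v = (x =ᶠ u) ∧ ((y =ᶠ v) ∧ K u v)
    Reversed u v = (y =ᶠ u) ∧ ((x =ᶠ v) ∧ K u v)

  monOf-graphOf : (L : List (Fin m × Fin m)) →
    monOf (graphOf L) ψ a b ≡ ∑₂ L (λ xy → H (proj₁ xy) (proj₂ xy))
  monOf-graphOf L = begin
    monOf (graphOf L) ψ a b
      ≡⟨ 𝔽₂.∑-filter (λ p → edgeParity L (proj₁ p) (proj₂ p)) (pairs m) (λ p → H (proj₁ p) (proj₂ p)) ⟩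
    ∑₂ (pairs m) (λ p → 𝔽₂.⟦ edgeParity L (proj₁ p) (proj₂ p) ⟧ ∧ H (proj₁ p) (proj₂ p))
      ≡⟨ 𝔽₂.∑-pairs m _ ⟩
    ∑₂ (allFin m) (λ u → ∑₂ (allFin m) (λ v → 𝔽₂.⟦ u <ᶠ v ⟧ ∧ (𝔽₂.⟦ edgeParity L u v ⟧ ∧ H u v)))
      ≡⟨ 𝔽₂.∑-cong (allFin m) (λ u → 𝔽₂.∑-cong (allFin m) (edge-term L u)) ⟩
    ∑₂ (allFin m) (λ u → ∑₂ (allFin m) (λ v → ∑₂ L (λ xy → W xy u v)))
      ≡⟨ 𝔽₂.∑-cong (allFin m) (λ u → 𝔽₂.∑-swap (allFin m) L (λ v xy → W xy u v)) ⟩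
    ∑₂ (allFin m) (λ u → ∑₂ L (λ xy → ∑₂ (allFin m) (W xy u)))
      ≡⟨ 𝔽₂.∑-swap (allFin m) L (λ u xy → ∑₂ (allFin m) (W xy u)) ⟩
    ∑₂ L (λ xy → ∑₂ (allFin m) (λ u → ∑₂ (allFin m) (W xy u)))
      ≡⟨ 𝔽₂.∑-cong L (λ xy → pair-term (proj₁ xy) (proj₂ xy)) ⟩
    ∑₂ L (λ xy → H (proj₁ xy) (proj₂ xy)) ∎
    where
    open ≡-Reasoning
    W : Fin m × Fin m → Fin m → Fin m → Bool
    W xy u v = hits u v (proj₁ xy) (proj₂ xy) ∧ K u v

open import Data.Nat using (_+_)

joinF : ∀ {n₁ n₂ s} → (Fin n₁ → Fin s) → (Fin n₂ → Fin s) → Fin (n₁ + n₂) → Fin s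
joinF {n₁} f₁ f₂ i = [ f₁ , f₂ ]′ (splitAt n₁ i)

joinF-↑ˡ : ∀ {n₁ n₂ s} (f₁ : Fin n₁ → Fin s) (f₂ : Fin n₂ → Fin s) i → joinF f₁ f₂ (i ↑ˡ n₂) ≡ f₁ i
joinF-↑ˡ {n₁} {n₂} f₁ f₂ i rewrite FinP.splitAt-↑ˡ n₁ i n₂ = refl

joinF-↑ʳ : ∀ {n₁ n₂ s} (f₁ : Fin n₁ → Fin s) (f₂ : Fin n₂ → Fin s) i → joinF f₁ f₂ (n₁ ↑ʳ i) ≡ f₂ i
joinF-↑ʳ {n₁} {n₂} f₁ f₂ i rewrite FinP.splitAt-↑ʳ n₁ n₂ i = refl

joinF-consF : ∀ {n₁ n₂ s} (a : Fin s) (f₁ : Fin n₁ → Fin s) (f₂ : Fin n₂ → Fin s) i →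
  joinF (consF a f₁) f₂ i ≡ consF a (joinF f₁ f₂) i
joinF-consF a f₁ f₂ zero = refl
joinF-consF {n₁} a f₁ f₂ (suc i) with splitAt n₁ i
... | inj₁ _ = refl
... | inj₂ _ = refl

module SplitSums (R : CommutativeRing 0ℓ 0ℓ)
  (≈⇒≡ : ∀ {x y} → CommutativeRing._≈_ R x y → x ≡ y) where

  open CommutativeRing R using (Carrier)
  open FiniteSums R ≈⇒≡
  open MapSums R ≈⇒≡ using (Extensional; ∑maps-suc)
  open ≡-Reasoning

  ∑maps-split : ∀ n₁ n₂ s G → Extensional {n₁ + n₂} {s} G →
    ∑ (allMaps (n₁ + n₂) s) G ≡ ∑ (allMaps n₁ s) (λ f₁ → ∑ (allMaps n₂ s) (λ f₂ → G (joinF f₁ f₂)))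
  ∑maps-split zero      n₂ s G G-ext = sym (+-identityʳ _)
  ∑maps-split (suc n₁) n₂ s G G-ext = begin
    ∑ (allMaps (suc (n₁ + n₂)) s) G
      ≡⟨ ∑maps-suc (n₁ + n₂) s G ⟩
    ∑ (allMaps (n₁ + n₂) s) G⁺
      ≡⟨ ∑maps-split n₁ n₂ s G⁺ (λ f≗g → ∑-cong (allFin s) (λ a → G-ext (consF-cong a f≗g))) ⟩
    ∑ (allMaps n₁ s) (λ f₁ → ∑ (allMaps n₂ s) (λ f₂ → G⁺ (joinF f₁ f₂)))
      ≡⟨ ∑-cong (allMaps n₁ s) (λ f₁ → ∑-swap (allMaps n₂ s) (allFin s) (λ f₂ a → G (consF a (joinF f₁ f₂)))) ⟩
    ∑ (allMaps n₁ s) (λ f₁ → ∑ (allFin s) (λ a → ∑ (allMaps n₂ s) (λ f₂ → G (consF a (joinF f₁ f₂)))))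
      ≡⟨ ∑-cong (allMaps n₁ s) (λ f₁ → ∑-cong (allFin s) (λ a → ∑-cong (allMaps n₂ s) (λ f₂ →
           G-ext (λ i → sym (joinF-consF a f₁ f₂ i))))) ⟩
    ∑ (allMaps n₁ s) (λ f₁ → ∑ (allFin s) (λ a → G₁ (consF a f₁)))
      ≡⟨ sym (∑maps-suc n₁ s G₁) ⟩
    ∑ (allMaps (suc n₁) s) G₁ ∎
    where
    G⁺ : (Fin (n₁ + n₂) → Fin s) → Carrier
    G⁺ f = ∑ (allFin s) (λ a → G (consF a f))
    G₁ : (Fin (suc n₁) → Fin s) → Carrier
    G₁ f₁ = ∑ (allMaps n₂ s) (λ f₂ → G (joinF f₁ f₂))

-- Integer sums: coeff in Defs is such a sum.
module ℤΣ = FiniteSums ℤP.+-*-commutativeRing (λ e → e)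
module ℤMaps = MapSums ℤP.+-*-commutativeRing (λ e → e)
module ℤSplit = SplitSums ℤP.+-*-commutativeRing (λ e → e)
open ℤΣ using (∑; ⟦_⟧)

monEq-cong : ∀ {s} (M M₁ M₂ : Mon s) → (∀ a b → ¬ a ≡ b → M₁ a b ≡ M₂ a b) → monEq M M₁ ≡ monEq M M₂
monEq-cong {s} M M₁ M₂ M₁≈M₂ = cong and (agree (pairs s) (All.tabulate ∈-pairs⁻))
  where
  agree : ∀ ps → All (λ p → proj₁ p < proj₂ p) ps →
    map (λ p → not (M (proj₁ p) (proj₂ p) xor M₁ (proj₁ p) (proj₂ p))) ps ≡
    map (λ p → not (M (proj₁ p) (proj₂ p) xor M₂ (proj₁ p) (proj₂ p))) ps
  agree []             []            = refl
  agree ((u , v) ∷ ps) (u<v ∷ u<vs) =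
    cong₂ _∷_ (cong (λ t → not (M u v xor t)) (M₁≈M₂ u v (λ u≡v → FinP.<-irrefl u≡v u<v))) (agree ps u<vs)

monOf-cong : ∀ {n s} (J : Graph n) {f g : Fin n → Fin s} → (∀ i → f i ≡ g i) → ∀ a b → monOf J f a b ≡ monOf J g a b
monOf-cong J f≗g a b = 𝔽₂.∑-cong (edges J) (λ uv → cong₂ (hits a b) (f≗g (proj₁ uv)) (f≗g (proj₂ uv)))

coeffTerm : ∀ {s} → Mon s → ℤ × Mon s → ℤ
coeffTerm M cm = if monEq M (proj₂ cm) then proj₁ cm else 0ℤ

coeff-jtilde : ∀ {n} (J : Graph n) s (M : Mon s) → coeff M (jtilde J s) ≡ ∑ (inj n s) (λ φ → ⟦ monEq M (monOf J φ) ⟧)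
coeff-jtilde {n} J s M = ℤΣ.∑-map (λ φ → (1ℤ , monOf J φ)) (inj n s) (coeffTerm M)

coeff-product : ∀ {n₁ n₂} (J₁ : Graph n₁) (J₂ : Graph n₂) s (M : Mon s) →
  coeff M (jtilde J₁ s ⊗ jtilde J₂ s) ≡
  ∑ (inj n₁ s) (λ φ₁ → ∑ (inj n₂ s) (λ φ₂ → ⟦ monEq M (monMul (monOf J₁ φ₁) (monOf J₂ φ₂)) ⟧))
coeff-product {n₁} {n₂} J₁ J₂ s M = begin
  coeff M (jtilde J₁ s ⊗ jtilde J₂ s)
    ≡⟨ ℤΣ.∑-concatMap (λ cm → map (times cm) (jtilde J₂ s)) (jtilde J₁ s) (coeffTerm M) ⟩
  ∑ (jtilde J₁ s) (λ cm → ∑ (map (times cm) (jtilde J₂ s)) (coeffTerm M))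
    ≡⟨ ℤΣ.∑-map (λ φ → (1ℤ , monOf J₁ φ)) (inj n₁ s) (λ cm → ∑ (map (times cm) (jtilde J₂ s)) (coeffTerm M)) ⟩
  ∑ (inj n₁ s) (λ φ₁ → ∑ (map (times (1ℤ , monOf J₁ φ₁)) (jtilde J₂ s)) (coeffTerm M))
    ≡⟨ ℤΣ.∑-cong (inj n₁ s) (λ φ₁ →
         trans (ℤΣ.∑-map (times (1ℤ , monOf J₁ φ₁)) (jtilde J₂ s) (coeffTerm M))
               (ℤΣ.∑-map (λ φ → (1ℤ , monOf J₂ φ)) (inj n₂ s) (coeffTerm M ∘ times (1ℤ , monOf J₁ φ₁)))) ⟩
  ∑ (inj n₁ s) (λ φ₁ → ∑ (inj n₂ s) (λ φ₂ → ⟦ monEq M (monMul (monOf J₁ φ₁) (monOf J₂ φ₂)) ⟧)) ∎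
  where
  open ≡-Reasoning
  times : ℤ × Mon s → ℤ × Mon s → ℤ × Mon s
  times (c , m) (d , m') = (c *ℤ d , monMul m m')

coeff-sumP : ∀ {s} (M : Mon s) (ps : List (Poly s)) → coeff M (sumP ps) ≡ ∑ ps (coeff M)
coeff-sumP M []       = refl
coeff-sumP M (p ∷ ps) = trans (ℤΣ.∑-++ p (sumP ps) (coeffTerm M)) (cong (coeff M p +ℤ_) (coeff-sumP M ps))

module Product {n₁ n₂ : ℕ} (J₁ : Graph n₁) (J₂ : Graph n₂) (s : ℕ) where

  open ≡-Reasoning

  inl : Fin n₁ → Fin (n₁ + n₂)
  inl i = i ↑ˡ n₂

  inr : Fin n₂ → Fin (n₁ + n₂)
  inr i = n₁ ↑ʳ i

  injectiveOnSides : ∀ {t} → (Fin (n₁ + n₂) → Fin t) → Bool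
  injectiveOnSides Φ = isInjective (Φ ∘ inl) ∧ isInjective (Φ ∘ inr)

  unionEdges : ∀ {m} → Pattern (n₁ + n₂) m → List (Fin m × Fin m)
  unionEdges p = map (λ uv → (collapse p (inl (proj₁ uv)) , collapse p (inl (proj₂ uv)))) (edges J₁)
              ++ map (λ uv → (collapse p (inr (proj₁ uv)) , collapse p (inr (proj₂ uv)))) (edges J₂)

  unionGraph : SomePattern (n₁ + n₂) → Σ ℕ Graph
  unionGraph (m , p) = (m , graphOf (unionEdges p))

  admissible : List (SomePattern (n₁ + n₂))
  admissible = filterᵇ (λ mp → injectiveOnSides (collapse (proj₂ mp))) (patterns (n₁ + n₂))

  Js : List (Σ ℕ Graph)
  Js = map unionGraph admissible

  Js-bounded : All (λ kJ → proj₁ kJ ≤ n₁ + n₂) Js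
  Js-bounded = All.tabulate λ mem → bounded (∈-map⁻ unionGraph mem)
    where
    bounded : ∀ {kJ} → Σ (SomePattern (n₁ + n₂)) (λ mp → mp ∈ admissible × kJ ≡ unionGraph mp) → proj₁ kJ ≤ n₁ + n₂
    bounded ((m , p) , _ , refl) = pattern-size p

  monOf-unionGraph : ∀ {m} (p : Pattern (n₁ + n₂) m) (ψ : Fin m → Fin s) a b → ¬ a ≡ b →
    monMul (monOf J₁ (ψ ∘ collapse p ∘ inl)) (monOf J₂ (ψ ∘ collapse p ∘ inr)) a b ≡ monOf (graphOf (unionEdges p)) ψ a b
  monOf-unionGraph {m} p ψ a b a≢b = sym (begin
    monOf (graphOf (unionEdges p)) ψ a b
      ≡⟨ monOf-graphOf (unionEdges p) ⟩
    ∑₂ (unionEdges p) H′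
      ≡⟨ 𝔽₂.∑-++ (map side₁ (edges J₁)) (map side₂ (edges J₂)) H′ ⟩
    ∑₂ (map side₁ (edges J₁)) H′ xor ∑₂ (map side₂ (edges J₂)) H′
      ≡⟨ cong₂ _xor_ (𝔽₂.∑-map side₁ (edges J₁) H′) (𝔽₂.∑-map side₂ (edges J₂) H′) ⟩
    monMul (monOf J₁ (ψ ∘ collapse p ∘ inl)) (monOf J₂ (ψ ∘ collapse p ∘ inr)) a b ∎)
    where
    open EdgeListMonomial ψ a≢b using (H; monOf-graphOf)
    H′ : Fin m × Fin m → Bool
    H′ xy = H (proj₁ xy) (proj₂ xy)
    side₁ : Fin n₁ × Fin n₁ → Fin m × Fin m
    side₁ uv = (collapse p (inl (proj₁ uv)) , collapse p (inl (proj₂ uv)))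
    side₂ : Fin n₂ × Fin n₂ → Fin m × Fin m
    side₂ uv = (collapse p (inr (proj₁ uv)) , collapse p (inr (proj₂ uv)))

  module Coefficient (M : Mon s) where

    produces : (Fin n₁ → Fin s) → (Fin n₂ → Fin s) → ℤ
    produces f₁ f₂ = ⟦ monEq M (monMul (monOf J₁ f₁) (monOf J₂ f₂)) ⟧

    G : (Fin (n₁ + n₂) → Fin s) → ℤ
    G Φ = ⟦ injectiveOnSides Φ ⟧ *ℤ produces (Φ ∘ inl) (Φ ∘ inr)

    G-restrictions : ∀ Φ {f₁ f₂} → (∀ i → Φ (inl i) ≡ f₁ i) → (∀ i → Φ (inr i) ≡ f₂ i) →
      G Φ ≡ ⟦ isInjective f₁ ∧ isInjective f₂ ⟧ *ℤ produces f₁ f₂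
    G-restrictions Φ Φ₁≗f₁ Φ₂≗f₂ = cong₂ _*ℤ_
      (cong₂ (λ x y → ⟦ x ∧ y ⟧) (isInjective-cong _ _ Φ₁≗f₁) (isInjective-cong _ _ Φ₂≗f₂))
      (cong ⟦_⟧ (monEq-cong M _ _ (λ a b _ → cong₂ _xor_ (monOf-cong J₁ Φ₁≗f₁ a b) (monOf-cong J₂ Φ₂≗f₂ a b))))

    G-ext : ℤMaps.Extensional G
    G-ext {Φ} Φ≗Ψ = G-restrictions Φ (Φ≗Ψ ∘ inl) (Φ≗Ψ ∘ inr)

    coeff-as-∑maps : coeff M (jtilde J₁ s ⊗ jtilde J₂ s) ≡ ∑ (allMaps (n₁ + n₂) s) G
    coeff-as-∑maps = begin
      coeff M (jtilde J₁ s ⊗ jtilde J₂ s)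
        ≡⟨ coeff-product J₁ J₂ s M ⟩
      ∑ (inj n₁ s) (λ φ₁ → ∑ (inj n₂ s) (produces φ₁))
        ≡⟨ ℤΣ.∑∑-filter isInjective isInjective (allMaps n₁ s) (allMaps n₂ s) produces ⟩
      ∑ (allMaps n₁ s) (λ f₁ → ∑ (allMaps n₂ s) (λ f₂ → ⟦ isInjective f₁ ∧ isInjective f₂ ⟧ *ℤ produces f₁ f₂))
        ≡⟨ ℤΣ.∑-cong (allMaps n₁ s) (λ f₁ → ℤΣ.∑-cong (allMaps n₂ s) (λ f₂ →
             sym (G-restrictions (joinF f₁ f₂) (joinF-↑ˡ f₁ f₂) (joinF-↑ʳ f₁ f₂)))) ⟩
      ∑ (allMaps n₁ s) (λ f₁ → ∑ (allMaps n₂ s) (λ f₂ → G (joinF f₁ f₂)))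
        ≡⟨ sym (ℤSplit.∑maps-split n₁ n₂ s G G-ext) ⟩
      ∑ (allMaps (n₁ + n₂) s) G ∎

    patternTerm-union : ∀ mp → ℤMaps.patternTerm G mp ≡
      ⟦ injectiveOnSides (collapse (proj₂ mp)) ⟧ *ℤ coeff M (jtilde (proj₂ (unionGraph mp)) s)
    patternTerm-union (m , p) = begin
      ∑ (inj m s) (λ ψ → G (ψ ∘ collapse p))
        ≡⟨ ℤΣ.∑-filter-cong isInjective (allMaps m s) factor ⟩
      ∑ (inj m s) (λ ψ → ⟦ injectiveOnSides (collapse p) ⟧ *ℤ ⟦ monEq M (monOf (graphOf (unionEdges p)) ψ) ⟧)
        ≡⟨ ℤΣ.∑-*ˡ (inj m s) ⟦ injectiveOnSides (collapse p) ⟧ (λ ψ → ⟦ monEq M (monOf (graphOf (unionEdges p)) ψ) ⟧) ⟩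
      ⟦ injectiveOnSides (collapse p) ⟧ *ℤ ∑ (inj m s) (λ ψ → ⟦ monEq M (monOf (graphOf (unionEdges p)) ψ) ⟧)
        ≡⟨ cong (⟦ injectiveOnSides (collapse p) ⟧ *ℤ_) (sym (coeff-jtilde (graphOf (unionEdges p)) s M)) ⟩
      ⟦ injectiveOnSides (collapse p) ⟧ *ℤ coeff M (jtilde (graphOf (unionEdges p)) s) ∎
      where
      factor : ∀ ψ → isInjective ψ ≡ true →
        G (ψ ∘ collapse p) ≡ ⟦ injectiveOnSides (collapse p) ⟧ *ℤ ⟦ monEq M (monOf (graphOf (unionEdges p)) ψ) ⟧
      factor ψ ψ? = cong₂ _*ℤ_
        (cong₂ (λ x y → ⟦ x ∧ y ⟧) (isInjective-∘ ψ (collapse p ∘ inl) ψ-inj)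
                                   (isInjective-∘ ψ (collapse p ∘ inr) ψ-inj))
        (cong ⟦_⟧ (monEq-cong M _ _ (monOf-unionGraph p ψ)))
        where
        ψ-inj : Injective _≡_ _≡_ ψ
        ψ-inj = isInjective-sound ψ ψ?

    coeff-decomposition : coeff M (jtilde J₁ s ⊗ jtilde J₂ s) ≡ coeff M (sumP (map (λ kJ → jtilde (proj₂ kJ) s) Js))
    coeff-decomposition = begin
      coeff M (jtilde J₁ s ⊗ jtilde J₂ s)
        ≡⟨ coeff-as-∑maps ⟩
      ∑ (allMaps (n₁ + n₂) s) G
        ≡⟨ ℤMaps.∑maps-by-pattern (n₁ + n₂) s G G-ext ⟩
      ∑ (patterns (n₁ + n₂)) (ℤMaps.patternTerm G)
        ≡⟨ ℤΣ.∑-cong (patterns (n₁ + n₂)) patternTerm-union ⟩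
      ∑ (patterns (n₁ + n₂)) (λ mp → ⟦ injectiveOnSides (collapse (proj₂ mp)) ⟧ *ℤ coeff M (jtilde (proj₂ (unionGraph mp)) s))
        ≡⟨ sym (ℤΣ.∑-filter (λ mp → injectiveOnSides (collapse (proj₂ mp))) (patterns (n₁ + n₂)) _) ⟩
      ∑ admissible (λ mp → coeff M (jtilde (proj₂ (unionGraph mp)) s))
        ≡⟨ sym (ℤΣ.∑-map unionGraph admissible (λ kJ → coeff M (jtilde (proj₂ kJ) s))) ⟩
      ∑ Js (λ kJ → coeff M (jtilde (proj₂ kJ) s))
        ≡⟨ sym (ℤΣ.∑-map (λ kJ → jtilde (proj₂ kJ) s) Js (coeff M)) ⟩
      ∑ (map (λ kJ → jtilde (proj₂ kJ) s) Js) (coeff M)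
        ≡⟨ sym (coeff-sumP M (map (λ kJ → jtilde (proj₂ kJ) s) Js)) ⟩
      coeff M (sumP (map (λ kJ → jtilde (proj₂ kJ) s) Js)) ∎

mainTheorem5 : (n₁ n₂ : ℕ) (J₁ : Graph n₁) (J₂ : Graph n₂) (s : ℕ) →
    Σ (List (Σ ℕ Graph)) λ Js →
      All (λ kJ → proj₁ kJ ≤ n₁ + n₂) Js
      × ((jtilde J₁ s ⊗ jtilde J₂ s) ≈ᴿ sumP (map (λ kJ → jtilde (proj₂ kJ) s) Js))
mainTheorem5 n₁ n₂ J₁ J₂ s = Js , Js-bounded , λ M → Coefficient.coeff-decomposition M
  where open Product J₁ J₂ s
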